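{- Let $P$ be a length-$n$ read-once branching program over alphabet $\{0,1\}^k$ ($k\ge1$), with rectangle labels $R(v)$ and collections $\mathcal R_t$ as defined in the context. Then: (1) $\mathcal R_0=\{[0,0]^k\}$, and for every $0\le t\le n-1$, every $R\in\mathcal R_t$ and every $z\in\{0,1\}^k$, the set $R+z$ is contained in some rectangle in $\mathcal R_{t+1}$; (2) if $P$ has width $w$ then $|\mathcal R_t|\le w$ for all $0\le t\le n$; (3) if $P$ computes $\mathsf{ApproxCount}_{k\text{ -parallel}}[n,\Delta]$, then every rectangle $[a_1,b_1]\times\cdots\times[a_k,b_k]\in\mathcal R_n$ satisfies $b_j-a_j\le2\Delta$ for all $j\in[k]$.
   Context: A length-$n$ read-once branching program (ROBP) over a finite alphabet $\Sigma$: layered multigraph with layers $V_0,\dots,V_n$, $V_0=\{v_{\mathrm{start}}\}$, each vertex of $V_i$ ($i<n$) having $|\Sigma|$ outgoing edges into $V_{i+1}$ labeled by distinct symbols, vertices of $V_n$ labeled with outputs, every vertex reachable by some input. An input follows from $v_{\mathrm{start}}$ the edges labeled $x_1,\dots,x_n$, the output is the label of the final vertex, and a prefix $(x_1,\dots,x_t)$ reaches the vertex of $V_t$ on the path. Width is $\max_i|V_i|$. $\mathsf{ApproxCount}_{k\text{ -parallel}}[n,\Delta]$: on input $x=(x_1,\dots,x_n)\in(\{0,1\}^k)^n$ output reals $(\hat S_1,\dots,\hat S_k)$ with $|\hat S_j-\#\{i\in[n]:(x_i)_j=1\}|\le\Delta$ for all $j\in[k]$; $P$ computes it if the output is valid on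 every input. Rectangle labeling: for $v\in V_t$, $R(v)=[a_1,b_1]\times\cdots\times[a_k,b_k]$ where $a_j,b_j$ are the minimum and maximum of $\#\{i\in[t]:(x_i)_j=1\}$ over prefixes $(x_1,\dots,x_t)\in(\{0,1\}^k)^t$ reaching $v$; $\mathcal R_t=\{R(v):v\in V_t\}$. $R+z=\{r+z:r\in R\}$.
   Formalization: The output labels of P, the estimates $(\hat S_1,\dots,\hat S_k)$, are k-tuples of rationals rather than reals, and the parameter Δ is likewise rational. -}

module Defs where

open import Data.Nat using (ℕ; zero; suc; _+_; _≤_; _⊓_; _⊔_)
import Data.Nat.Properties as ℕP
open import Data.Bool using (Bool; true; false; if_then_else_)
open import Data.Fin using (Fin) renaming (zero to fzero)
import Data.Fin.Properties as FinP
open import Data.Vec using (Vec; []; _∷_; init; last; lookup; tabulate; zipWith)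
import Data.Vec.Properties as VecP
open import Data.List using (List; []; _∷_; map; foldr; concatMap; filter; length; deduplicate; upTo; allFin)
open import Data.Product using (Σ; ∃; _×_; _,_; proj₁; proj₂)
import Data.Product.Properties as ProdP
open import Relation.Binary.PropositionalEquality using (_≡_)
open import Relation.Binary.Definitions using (DecidableEquality)
open import Data.Integer using (+_)
open import Data.Rational using (ℚ; _/_; _-_; ∣_∣; _*_) renaming (_≤_ to _≤ℚ_)

-- Layer V_0 = Fin 1 (the start vertex), layer V_{t+1} =
-- Fin (sz t).  δ t is the (deterministic) edge function from V_t to V_{t+1}:
-- each vertex has exactly one outgoing edge per symbol (multigraph allowed).
-- Layers beyond n are irrelevant (never used below).

LayerSize : (ℕ → ℕ) → ℕ → ℕ
LayerSize sz zero    = 1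
LayerSize sz (suc t) = sz t

reachWith : {A : Set} (sz : ℕ → ℕ) →
            ((t : ℕ) → Fin (LayerSize sz t) → A → Fin (sz t)) →
            (t : ℕ) → Vec A t → Fin (LayerSize sz t)
reachWith sz δ zero    _  = fzero
reachWith sz δ (suc t) xs = δ t (reachWith sz δ t (init xs)) (last xs)

record ROBP (A : Set) (O : Set) (n : ℕ) : Set where
  field
    sz        : ℕ → ℕ
    δ         : (t : ℕ) → Fin (LayerSize sz t) → A → Fin (sz t)
    out       : Fin (LayerSize sz n) → O
    reachable : (t : ℕ) → t ≤ n → (v : Fin (LayerSize sz t)) →
                ∃ λ (xs : Vec A t) → reachWith sz δ t xs ≡ v

  V : ℕ → Set
  V t = Fin (LayerSize sz t)

  reach : (t : ℕ) → Vec A t → V t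
  reach = reachWith sz δ

  run : Vec A n → O
  run x = out (reach n x)

  width : ℕ
  width = foldr _⊔_ 0 (map (LayerSize sz) (upTo (suc n)))

open ROBP public

Sym : ℕ → Set
Sym k = Vec Bool k

bit : Bool → ℕ
bit b = if b then 1 else 0

count : {k t : ℕ} → Fin k → Vec (Sym k) t → ℕ
count j []       = 0
count j (x ∷ xs) = bit (lookup x j) + count j xs

allVecs : {A : Set} → List A → (t : ℕ) → List (Vec A t)
allVecs as zero    = [] ∷ []
allVecs as (suc t) = concatMap (λ a → map (a ∷_) (allVecs as t)) as

allSyms : (k : ℕ) → List (Sym k)
allSyms k = allVecs (true ∷ false ∷ []) k

-- minimum / maximum of a list of naturals (only used on nonempty lists)
minList : List ℕ → ℕ
minList []       = 0
minList (x ∷ xs) = foldr _⊓_ x xs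

maxList : List ℕ → ℕ
maxList = foldr _⊔_ 0

-- Rectangles [a_1,b_1] × ... × [a_k,b_k], stored as the vector of (a_j , b_j)

Rect : ℕ → Set
Rect k = Vec (ℕ × ℕ) k

_≟Rect_ : {k : ℕ} → DecidableEquality (Rect k)
_≟Rect_ = VecP.≡-dec (ProdP.≡-dec ℕP._≟_ ℕP._≟_)

_∈R_ : {k : ℕ} → Vec ℕ k → Rect k → Set
p ∈R R = ∀ j → proj₁ (lookup R j) ≤ lookup p j × lookup p j ≤ proj₂ (lookup R j)

_+z_ : {k : ℕ} → Vec ℕ k → Sym k → Vec ℕ k
p +z z = zipWith (λ a b → a + bit b) p z

ShiftSubset : {k : ℕ} → Rect k → Sym k → Rect k → Set
ShiftSubset {k} R z R' = (r : Vec ℕ k) → r ∈R R → (r +z z) ∈R R'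

zeroRect : (k : ℕ) → Rect k
zeroRect k = tabulate (λ _ → (0 , 0))

module _ {k n : ℕ} {O : Set} (P : ROBP (Sym k) O n) where

  reaching : (t : ℕ) → V P t → List (Vec (Sym k) t)
  reaching t v = filter (λ xs → reach P t xs FinP.≟ v) (allVecs (allSyms k) t)

  rect : (t : ℕ) → V P t → Rect k
  rect t v = tabulate λ j → ( minList (map (count j) (reaching t v))
                            , maxList (map (count j) (reaching t v)) )

  _∈𝓡_ : Rect k → ℕ → Set
  R ∈𝓡 t = ∃ λ (v : V P t) → rect t v ≡ R

  card𝓡 : ℕ → ℕ
  card𝓡 t = length (deduplicate _≟Rect_ (map (rect t) (allFin (LayerSize (sz P) t))))

toℚ : ℕ → ℚ
toℚ m = (+ m) / 1

Computes : {k n : ℕ} → ROBP (Sym k) (Vec ℚ k) n → ℚ → Set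
Computes {k} {n} P Δ = (x : Vec (Sym k) n) → (j : Fin k) →
  ∣ lookup (run P x) j - toℚ (count j x) ∣ ≤ℚ Δ

{-# OPTIONS --safe #-}
module Submission where

-- R(v) is spanned by the counts of the prefixes reaching v.  Appending z to a prefix reaching v
-- gives a prefix reaching δ v z whose counts are shifted by z, so the extreme corners of R(v) + z
-- lie in R(δ v z).  Labels come from vertices, so there are at most |V_t| of them.  In the last
-- layer all prefixes reaching v get the same output, which is within Δ of both the smallest and
-- the largest count, so these differ by at most 2Δ.

open import Defs
open import Data.Nat using (ℕ; suc; _≤_; _<_)
open import Data.Fin using (Fin)
open import Data.Vec using (Vec; lookup)
open import Data.Product using (_×_; ∃; proj₁; proj₂)
open import Function.Bundles using (_⇔_)
open import Relation.Binary.PropositionalEquality using (_≡_)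
open import Data.Rational using (ℚ; _-_; _*_) renaming (_≤_ to _≤ℚ_)

open import Data.Bool using (true; false)
open import Data.Nat using (zero; _+_; z≤n; s≤s)
open import Data.Nat.Properties
  using ( ≤-refl; ≤-reflexive; ≤-trans; ≤-antisym; <⇒≤; +-assoc; +-identityʳ; +-monoˡ-≤
        ; ⊓-sel; ⊔-sel; m≤n⇒m⊓o≤n; m≤n⇒o⊓m≤n; m≤n⇒m≤n⊔o; m≤n⇒m≤o⊔n; module ≤-Reasoning )
open import Data.Fin using () renaming (zero to fzero)
open import Data.Fin.Properties using () renaming (_≟_ to _≟Fin_)
open import Data.Vec using ([]; _∷_; _∷ʳ_)
open import Data.Vec.Properties using (init-∷ʳ; last-∷ʳ; lookup-zipWith; lookup∘tabulate)
open import Data.List using (List; []; _∷_; map; length; allFin)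
open import Data.List.Properties using (foldr-preservesᵒ; length-deduplicate; length-map; length-tabulate)
open import Data.List.Membership.Propositional using (_∈_)
open import Data.List.Membership.Propositional.Properties
  using (∈-map⁺; ∈-map⁻; ∈-concatMap⁺; ∈-filter⁺; ∈-filter⁻; ∈-upTo⁺; foldr-selective)
open import Data.List.Relation.Unary.Any as Any using (here; there; toSum)
open import Data.Product using (_,_)
open import Data.Sum using (inj₁; inj₂; [_,_]′)
open import Function.Bundles using (mk⇔)
open import Relation.Binary.PropositionalEquality using (refl; sym; cong; cong₂; subst; subst₂; module ≡-Reasoning)
open import Data.Integer using (-[1+_]) renaming (+_ to ℤ+)
open import Data.Rational using (mkℚ; ∣_∣) renaming (_+_ to _+ℚ_)
import Data.Rational.Properties as ℚP
open import Data.Rational.Solver using (module +-*-Solver)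

∈-allVecs : {A : Set} (as : List A) → (∀ a → a ∈ as) → ∀ t (xs : Vec A t) → xs ∈ allVecs as t
∈-allVecs as every zero    []       = here refl
∈-allVecs as every (suc t) (x ∷ xs) =
  ∈-concatMap⁺ (λ a → map (a ∷_) (allVecs as t))
    (Any.map (λ { refl → ∈-map⁺ (x ∷_) (∈-allVecs as every t xs) }) (every x))

∈-allSyms : ∀ k (z : Sym k) → z ∈ allSyms k
∈-allSyms k = ∈-allVecs _ ∈-bools k
  where
  ∈-bools : ∀ b → b ∈ true ∷ false ∷ []
  ∈-bools true  = here refl
  ∈-bools false = there (here refl)

minList-≤ : ∀ {y ys} → y ∈ ys → minList ys ≤ y
minList-≤ {ys = x ∷ xs} y∈ =
  foldr-preservesᵒ (λ a b → [ m≤n⇒m⊓o≤n b , m≤n⇒o⊓m≤n a ]′) x xs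
    (toSum (Any.map (λ y≡ → ≤-reflexive (sym y≡)) y∈))

≤-maxList : ∀ {y ys} → y ∈ ys → y ≤ maxList ys
≤-maxList {ys = ys} y∈ =
  foldr-preservesᵒ (λ a b → [ m≤n⇒m≤n⊔o b , m≤n⇒m≤o⊔n a ]′) 0 ys
    (inj₂ (Any.map ≤-reflexive y∈))

minList-∈ : ∀ {y ys} → y ∈ ys → minList ys ∈ ys
minList-∈ {ys = x ∷ xs} _ = [ here , there ]′ (foldr-selective ⊓-sel x xs)

maxList-∈ : ∀ {y ys} → y ∈ ys → maxList ys ∈ ys
maxList-∈ {y} {ys} y∈ with foldr-selective ⊔-sel 0 ys
... | inj₂ max∈ = max∈
-- the seed 0 need not occur in ys, but if it is the result then every member is 0
... | inj₁ max≡0 = subst (_∈ ys) (sym max≡y) y∈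
  where
  max≡y : maxList ys ≡ y
  max≡y = ≤-antisym (subst (_≤ y) (sym max≡0) z≤n) (≤-maxList y∈)

count-∷ʳ : ∀ {k t} (j : Fin k) (xs : Vec (Sym k) t) z →
           count j (xs ∷ʳ z) ≡ count j xs + bit (lookup z j)
count-∷ʳ j []       z = +-identityʳ (bit (lookup z j))
count-∷ʳ j (x ∷ xs) z = begin
  bit (lookup x j) + count j (xs ∷ʳ z)               ≡⟨ cong (bit (lookup x j) +_) (count-∷ʳ j xs z) ⟩
  bit (lookup x j) + (count j xs + bit (lookup z j)) ≡⟨ sym (+-assoc (bit (lookup x j)) _ _) ⟩
  bit (lookup x j) + count j xs + bit (lookup z j)   ∎
  where open ≡-Reasoning

p≤∣p∣ : ∀ p → p ≤ℚ ∣ p ∣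
p≤∣p∣ (mkℚ (ℤ+ _)    _ _) = ℚP.≤-refl
p≤∣p∣ p@(mkℚ -[1+ _ ] _ _) = ℚP.<⇒≤ (ℚP.neg<pos p ∣ p ∣)

∣o-a∣≤Δ⇒∣o-b∣≤Δ⇒b-a≤2Δ : ∀ o a b {Δ} → ∣ o - a ∣ ≤ℚ Δ → ∣ o - b ∣ ≤ℚ Δ → b - a ≤ℚ toℚ 2 * Δ
∣o-a∣≤Δ⇒∣o-b∣≤Δ⇒b-a≤2Δ o a b {Δ} ∣o-a∣≤Δ ∣o-b∣≤Δ = begin
  b - a                    ≡⟨ solve 3 (λ o a b → b :- a := (o :- a) :- (o :- b)) refl o a b ⟩
  (o - a) - (o - b)        ≤⟨ p≤∣p∣ _ ⟩
  ∣ (o - a) - (o - b) ∣    ≤⟨ ℚP.∣p-q∣≤∣p∣+∣q∣ (o - a) (o - b) ⟩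
  ∣ o - a ∣ +ℚ ∣ o - b ∣   ≤⟨ ℚP.+-mono-≤ ∣o-a∣≤Δ ∣o-b∣≤Δ ⟩
  Δ +ℚ Δ                   ≡⟨ solve 1 (λ d → d :+ d := con (toℚ 2) :* d) refl Δ ⟩
  toℚ 2 * Δ                ∎
  where
  open ℚP.≤-Reasoning
  open +-*-Solver

module _ {k n : ℕ} {O : Set} (P : ROBP (Sym k) O n) where

  counts : (t : ℕ) → V P t → Fin k → List ℕ
  counts t v j = map (count j) (reaching P t v)

  lookup-rect : ∀ t (v : V P t) j → lookup (rect P t v) j ≡ (minList (counts t v j) , maxList (counts t v j))
  lookup-rect t v j = lookup∘tabulate _ j

  ∈-reaching⁺ : ∀ {t v} {xs : Vec (Sym k) t} → reach P t xs ≡ v → xs ∈ reaching P t v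
  ∈-reaching⁺ {t} {v} {xs} = ∈-filter⁺ (λ ys → reach P t ys ≟Fin v) (∈-allVecs (allSyms k) (∈-allSyms k) t xs)

  ∈-reaching⁻ : ∀ {t v} {xs : Vec (Sym k) t} → xs ∈ reaching P t v → reach P t xs ≡ v
  ∈-reaching⁻ {t} {v} xs∈ = proj₂ (∈-filter⁻ (λ ys → reach P t ys ≟Fin v) {xs = allVecs (allSyms k) t} xs∈)

  reach-∷ʳ : ∀ {t v} {xs : Vec (Sym k) t} z → reach P t xs ≡ v → reach P (suc t) (xs ∷ʳ z) ≡ δ P t v z
  reach-∷ʳ {t} {xs = xs} z refl = cong₂ (λ ys y → δ P t (reach P t ys) y) (init-∷ʳ z xs) (last-∷ʳ z xs)

  count-∈-counts : ∀ {t v} {xs : Vec (Sym k) t} j → reach P t xs ≡ v → count j xs ∈ counts t v j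
  count-∈-counts j reaches = ∈-map⁺ (count j) (∈-reaching⁺ reaches)

  extremum-attained : (ext : List ℕ → ℕ) → (∀ {y ys} → y ∈ ys → ext ys ∈ ys) →
                      ∀ {t} → t ≤ n → (v : V P t) (j : Fin k) →
                      ∃ λ xs → reach P t xs ≡ v × ext (counts t v j) ≡ count j xs
  extremum-attained ext ext-∈ {t} t≤n v j =
    let xs , xs∈ , ext≡ = ∈-map⁻ (count j) (ext-∈ (count-∈-counts {t} {v} j (proj₂ (reachable P t t≤n v))))
    in  xs , ∈-reaching⁻ xs∈ , ext≡

  minList-counts-step : ∀ {t} → t ≤ n → (v : V P t) (z : Sym k) (j : Fin k) →
                        minList (counts (suc t) (δ P t v z) j) ≤ minList (counts t v j) + bit (lookup z j)
  minList-counts-step {t} t≤n v z j =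
    let xs , reaches , min≡ = extremum-attained minList minList-∈ t≤n v j
    in  begin
      minList (counts (suc t) (δ P t v z) j)    ≤⟨ minList-≤ (count-∈-counts j (reach-∷ʳ z reaches)) ⟩
      count j (xs ∷ʳ z)                         ≡⟨ count-∷ʳ j xs z ⟩
      count j xs + bit (lookup z j)             ≡⟨ cong (_+ bit (lookup z j)) (sym min≡) ⟩
      minList (counts t v j) + bit (lookup z j) ∎
    where open ≤-Reasoning

  maxList-counts-step : ∀ {t} → t ≤ n → (v : V P t) (z : Sym k) (j : Fin k) →
                        maxList (counts t v j) + bit (lookup z j) ≤ maxList (counts (suc t) (δ P t v z) j)
  maxList-counts-step {t} t≤n v z j =
    let xs , reaches , max≡ = extremum-attained maxList maxList-∈ t≤n v j
    in  begin
      maxList (counts t v j) + bit (lookup z j) ≡⟨ cong (_+ bit (lookup z j)) max≡ ⟩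
      count j xs + bit (lookup z j)             ≡⟨ count-∷ʳ j xs z ⟨
      count j (xs ∷ʳ z)                         ≤⟨ ≤-maxList (count-∈-counts j (reach-∷ʳ z reaches)) ⟩
      maxList (counts (suc t) (δ P t v z) j)    ∎
    where open ≤-Reasoning

  rect-shift-⊆ : ∀ {t} → t ≤ n → (v : V P t) (z : Sym k) → ShiftSubset (rect P t v) z (rect P (suc t) (δ P t v z))
  rect-shift-⊆ {t} t≤n v z r r∈R j
    rewrite lookup-zipWith (λ a b → a + bit b) j r z | lookup-rect (suc t) (δ P t v z) j
    with r∈R j
  ... | low≤r , r≤high rewrite lookup-rect t v j =
    ≤-trans (minList-counts-step t≤n v z j) (+-monoˡ-≤ _ low≤r) ,
    ≤-trans (+-monoˡ-≤ _ r≤high) (maxList-counts-step t≤n v z j)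

  ∈𝓡-zero⇔ : (R : Rect k) → _∈𝓡_ P R 0 ⇔ (R ≡ zeroRect k)
  ∈𝓡-zero⇔ _ = mk⇔ (λ { (fzero , refl) → refl }) (λ { refl → fzero , refl })

  ∈𝓡-shift : ∀ {t} → t < n → (R : Rect k) → _∈𝓡_ P R t → (z : Sym k) →
             ∃ λ R' → _∈𝓡_ P R' (suc t) × ShiftSubset R z R'
  ∈𝓡-shift {t} t<n _ (v , refl) z = rect P (suc t) (δ P t v z) , (δ P t v z , refl) , rect-shift-⊆ (<⇒≤ t<n) v z

  layerSize≤width : ∀ {t} → t ≤ n → LayerSize (sz P) t ≤ width P
  layerSize≤width t≤n = ≤-maxList (∈-map⁺ (LayerSize (sz P)) (∈-upTo⁺ (s≤s t≤n)))

  card𝓡≤layerSize : ∀ t → card𝓡 P t ≤ LayerSize (sz P) t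
  card𝓡≤layerSize t = begin
    card𝓡 P t                          ≤⟨ length-deduplicate _≟Rect_ (map (rect P t) (allFin m)) ⟩
    length (map (rect P t) (allFin m)) ≡⟨ length-map (rect P t) (allFin m) ⟩
    length (allFin m)                  ≡⟨ length-tabulate (λ i → i) ⟩
    m                                  ∎
    where
    m = LayerSize (sz P) t
    open ≤-Reasoning

rect-spread≤2Δ : ∀ {k n} (P : ROBP (Sym k) (Vec ℚ k) n) (Δ : ℚ) → Computes P Δ → (v : V P n) (j : Fin k) →
                 toℚ (proj₂ (lookup (rect P n v) j)) - toℚ (proj₁ (lookup (rect P n v) j)) ≤ℚ toℚ 2 * Δ
rect-spread≤2Δ {n = n} P Δ computes v j rewrite lookup-rect P n v j =
  let xs₋ , reaches₋ , min≡ = extremum-attained P minList minList-∈ ≤-refl v j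
      xs₊ , reaches₊ , max≡ = extremum-attained P maxList maxList-∈ ≤-refl v j
  in  subst₂ (λ b a → toℚ b - toℚ a ≤ℚ toℚ 2 * Δ) (sym max≡) (sym min≡)
        (∣o-a∣≤Δ⇒∣o-b∣≤Δ⇒b-a≤2Δ (lookup (out P v) j) (toℚ (count j xs₋)) (toℚ (count j xs₊))
          (close reaches₋) (close reaches₊))
  where
  close : ∀ {xs} → reach P n xs ≡ v → ∣ lookup (out P v) j - toℚ (count j xs) ∣ ≤ℚ Δ
  close {xs} refl = computes xs j

proposition5p3 : {n k : ℕ} → 1 ≤ k → (P : ROBP (Sym k) (Vec ℚ k) n) →
    ( ((R : Rect k) → (_∈𝓡_ P R 0 ⇔ (R ≡ zeroRect k)))
    × ((t : ℕ) → t < n → (R : Rect k) → _∈𝓡_ P R t → (z : Sym k) →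
    ∃ λ (R' : Rect k) → _∈𝓡_ P R' (suc t) × ShiftSubset R z R') )
    × ((w : ℕ) → width P ≡ w → (t : ℕ) → t ≤ n → card𝓡 P t ≤ w)
    × ((Δ : ℚ) → Computes P Δ → (R : Rect k) → _∈𝓡_ P R n → (j : Fin k) →
    toℚ (proj₂ (lookup R j)) - toℚ (proj₁ (lookup R j)) ≤ℚ toℚ 2 * Δ)
proposition5p3 _ P =
    (∈𝓡-zero⇔ P , λ t → ∈𝓡-shift P)
  , (λ { w refl t t≤n → ≤-trans (card𝓡≤layerSize P t) (layerSize≤width P t≤n) })
  , λ { Δ computes _ (v , refl) → rect-spread≤2Δ P Δ computes v }
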